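{- For every $n\ge 1$, the statistics ${\sf dexc}$ and ${\sf ddes}$ are equidistributed over the symmetric group ${\cal S}_n$, and moreover the pairs of statistics $({\sf exc},{\sf dexc})$ and $({\sf des},{\sf ddes})$ are equidistributed over ${\cal S}_n$; that is, for all integers $e,k$, \[|\{\pi\in{\cal S}_n:{\sf exc}(\pi)=e,\ {\sf dexc}(\pi)=k\}|=|\{\pi\in{\cal S}_n:{\sf des}(\pi)=e,\ {\sf ddes}(\pi)=k\}|.\]
   Context: Permutations $\pi\in{\cal S}_n$ are written as words $\pi_1\cdots\pi_n$ with $\pi_i=\pi(i)$. An excedance of $\pi$ is an integer $i\in[n-1]$ with $\pi_i>i$; ${\sf E}(\pi)$ is the set of excedances and ${\sf exc}(\pi)=|{\sf E}(\pi)|$. A descent of $\pi$ is an integer $i\in[n-1]$ with $\pi_i>\pi_{i+1}$; ${\sf D}(\pi)$ is the set of descents and ${\sf des}(\pi)=|{\sf D}(\pi)|$. The excedance difference is ${\sf dexc}(\pi)=\sum_{i\in{\sf E}(\pi)}(\pi_i-i)$ and the descent difference is ${\sf ddes}(\pi)=\sum_{i\in{\sf D}(\pi)}(\pi_i-\pi_{i+1})$. -}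

module Defs where

open import Data.Nat using (ℕ; zero; suc; _+_; _∸_; _<ᵇ_)
open import Data.Bool using (Bool; true; false; if_then_else_; _∧_)
open import Data.Fin using (Fin; toℕ)
open import Data.List using (List; []; _∷_; concatMap; map; length; filter; allFin)
open import Data.Vec using (Vec; []; _∷_; lookup; tabulate)
open import Data.Fin.Properties using (all?)
open import Relation.Nullary using (Dec; ¬_)
open import Relation.Nullary.Decidable using (_×-dec_; ¬?; _→-dec_)
open import Relation.Binary.PropositionalEquality using (_≡_)
open import Data.Nat.Properties using (_≟_)
open import Data.Product using (_×_)
import Data.Fin.Properties as FinP

-- A permutation of [n] is written as a word π₁ ⋯ πₙ; we use 0-based
-- positions and values (Fin n), which shifts both i and πᵢ by one and
-- hence leaves all comparisons and differences πᵢ - i, πᵢ - πᵢ₊₁ unchanged.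
Word : ℕ → Set
Word n = Vec (Fin n) n

IsPerm : {n : ℕ} → Word n → Set
IsPerm {n} w = (i j : Fin n) → lookup w i ≡ lookup w j → i ≡ j

isPerm? : {n : ℕ} → (w : Word n) → Dec (IsPerm w)
isPerm? {n} w = all? λ i → all? λ j →
  (lookup w i FinP.≟ lookup w j) →-dec (i FinP.≟ j)

allWords : (n m : ℕ) → List (Vec (Fin n) m)
allWords n zero = [] ∷ []
allWords n (suc m) = concatMap (λ x → map (x ∷_) (allWords n m)) (allFin n)

vals : {n m : ℕ} → Vec (Fin n) m → List ℕ
vals [] = []
vals (x ∷ xs) = toℕ x ∷ vals xs

excAux : ℕ → List ℕ → ℕ
excAux i [] = 0
excAux i (p ∷ ps) = (if i <ᵇ p then 1 else 0) + excAux (suc i) ps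

dexcAux : ℕ → List ℕ → ℕ
dexcAux i [] = 0
dexcAux i (p ∷ ps) = (if i <ᵇ p then p ∸ i else 0) + dexcAux (suc i) ps

desAux : List ℕ → ℕ
desAux [] = 0
desAux (p ∷ []) = 0
desAux (p ∷ q ∷ ps) = (if q <ᵇ p then 1 else 0) + desAux (q ∷ ps)

ddesAux : List ℕ → ℕ
ddesAux [] = 0
ddesAux (p ∷ []) = 0
ddesAux (p ∷ q ∷ ps) = (if q <ᵇ p then p ∸ q else 0) + ddesAux (q ∷ ps)

exc dexc des ddes : {n : ℕ} → Word n → ℕ
exc w = excAux 0 (vals w)
dexc w = dexcAux 0 (vals w)
des w = desAux (vals w)
ddes w = ddesAux (vals w)

countPerms : (n : ℕ) → (P : Word n → Set) → ((w : Word n) → Dec (P w)) → ℕ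
countPerms n P P? = length (filter (λ w → isPerm? w ×-dec P? w) (allWords n n))

module Submission where

-- The bijection excToDes is built by induction on n, following the largest letter n. A permutation
-- of [n+1] arises from one of [n] by inserting n into a cycle right after some x (or as a fixed
-- point); the corresponding word arises by inserting n right before the letter x (or at the end).
-- Position x gains the excedance n − x and loses σ(x) − x, which moves to position n where it is no
-- excedance; the word gains the descent n > x and loses the descent p > x, p the letter before x.
-- The invariant that p = σ(x), or that neither exceeds x (Compatible), makes the two losses agree
-- and survives the insertion. Everything is proved for an arbitrary weight f i p vanishing when
-- p ≤ i, which covers exc/des (f = [p > i]) and dexc/ddes (f = p − i) at once. Finally excToDes is
-- injective on the finite set of permutations and maps it into itself, so it permutes it.

open import Defs
open import Data.Bool using (true; false; if_then_else_; T)
open import Data.Empty using (⊥-elim)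
open import Data.Fin using (Fin; zero; suc; toℕ; fromℕ; inject₁; lower₁; punchOut)
open import Data.Fin.Properties
  using (any?; toℕ-injective; toℕ-fromℕ; toℕ-inject₁; toℕ<n; inject₁-lower₁; inject₁-injective;
         fromℕ≢inject₁; punchOut-injective; pigeonhole; <-irrefl)
  renaming (_≟_ to _≟ᶠ_)
open import Data.Fin.Relation.Unary.Top using (view; ‵fromℕ; ‵inject₁)
open import Data.List using (List; []; _∷_; _++_; [_]; length; filter; concatMap; cartesianProductWith; allFin)
  renaming (map to mapₗ)
open import Data.List.Properties using (length-map)
open import Data.List.Membership.Propositional using () renaming (_∈_ to _∈ₗ_)
open import Data.List.Membership.Propositional.Properties
  using (∈-∃++; ∈-allFin; ∈-cartesianProductWith⁺; ∈-map⁻; ∈-filter⁺; ∈-filter⁻)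
open import Data.List.Relation.Binary.Subset.Propositional using (_⊆_)
open import Data.List.Relation.Binary.Permutation.Propositional
  using (_↭_; ↭-refl; ↭-sym; ↭-trans; prep; ↭⇒↭ₛ)
open import Data.List.Relation.Binary.Permutation.Propositional.Properties
  using (shift; ∈-resp-↭; ↭-length; filter-↭)
import Data.List.Relation.Binary.Permutation.Setoid.Properties as ↭ₛ
open import Data.List.Relation.Unary.All as All using ([])
import Data.List.Relation.Unary.All.Properties as AllP
open import Data.List.Relation.Unary.AllPairs using ([]; _∷_)
open import Data.List.Relation.Unary.Any using (here; there)
open import Data.List.Relation.Unary.Unique.Propositional using (Unique)
open import Data.List.Relation.Unary.Unique.Propositional.Properties as Unique using ()
open import Data.Maybe using (Maybe; just; nothing)
open import Data.Maybe.Relation.Unary.All as Maybe using (just; nothing)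
open import Data.Nat using (ℕ; zero; suc; z≤n; _+_; _∸_; _<ᵇ_; _≤_; _<_; _≥_; _≟_; s≤s⁻¹)
open import Data.Nat.Properties
  using (≤-refl; ≤-reflexive; ≤-trans; <⇒≤; <⇒≢; >⇒≢; ≤⇒≯; <ᵇ⇒<; n<1+n;
         +-identityʳ; +-suc; +-assoc; +-cancelʳ-≡)
open import Data.Nat.Tactic.RingSolver using (solve-∀)
open import Data.Product using (∃; _×_; _,_; proj₁; proj₂)
open import Data.Sum using (_⊎_; inj₁; inj₂)
open import Data.Unit using (tt)
open import Data.Vec using (Vec; []; _∷_; lookup; tabulate; map; _∷ʳ_; _[_]≔_)
open import Data.Vec.Properties
  using (lookup∘tabulate; lookup-map; tabulate∘lookup; tabulate-cong; lookup∘update; lookup∘update′;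
         ∷-injective; ∷-injectiveˡ; ∷-injectiveʳ; ∷ʳ-injective)
open import Data.Vec.Membership.Propositional using (_∈_)
open import Data.Vec.Membership.Propositional.Properties using (∈-map⁺)
open import Data.Vec.Relation.Unary.Any as Anyᵥ using (here; there)
open import Data.Vec.Relation.Unary.Any.Properties using (lookup-index)
open import Function using (_∘_)
open import Relation.Nullary using (Dec; yes; no; does)
open import Relation.Nullary.Decidable using (_×-dec_)
open import Relation.Unary using (Decidable)
open import Relation.Binary.PropositionalEquality
  using (_≡_; _≢_; refl; sym; trans; cong; cong₂; subst; ≢-sym; setoid; module ≡-Reasoning)

private
  variable
    A : Set
    k m n : ℕ

[x+y]+z≡[z+y]+x : ∀ x y z → (x + y) + z ≡ (z + y) + x
[x+y]+z≡[z+y]+x = solve-∀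

+-assoc-congʳ : ∀ x {a b c d} → a + c ≡ b + d → (x + a) + c ≡ (x + b) + d
+-assoc-congʳ x {a} {b} {c} {d} eq = trans (+-assoc x a c) (trans (cong (x +_) eq) (sym (+-assoc x b d)))

injective⇒surjective : (f : Fin n → Fin n) → (∀ i j → f i ≡ f j → i ≡ j) → ∀ y → ∃ λ i → f i ≡ y
injective⇒surjective {suc n} f inj y with any? (λ i → f i ≟ᶠ y)
... | yes hit = hit
... | no miss =
  let (i , j , i<j , squeezeᵢ≡squeezeⱼ) = pigeonhole (n<1+n n) (λ i → punchOut (y≢f i))
  in ⊥-elim (<-irrefl (inj i j (punchOut-injective (y≢f i) (y≢f j) squeezeᵢ≡squeezeⱼ)) i<j)
  where
  y≢f : ∀ i → y ≢ f i
  y≢f i y≡fi = miss (i , sym y≡fi)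

lookup-extensional : (xs ys : Vec A n) → (∀ i → lookup xs i ≡ lookup ys i) → xs ≡ ys
lookup-extensional xs ys eq =
  trans (sym (tabulate∘lookup xs)) (trans (tabulate-cong eq) (tabulate∘lookup ys))

lookup-∷ʳ-inject₁ : (xs : Vec A n) (y : A) (i : Fin n) → lookup (xs ∷ʳ y) (inject₁ i) ≡ lookup xs i
lookup-∷ʳ-inject₁ (x ∷ xs) y zero    = refl
lookup-∷ʳ-inject₁ (x ∷ xs) y (suc i) = lookup-∷ʳ-inject₁ xs y i

lookup-∷ʳ-fromℕ : (xs : Vec A n) (y : A) → lookup (xs ∷ʳ y) (fromℕ n) ≡ y
lookup-∷ʳ-fromℕ []       y = refl
lookup-∷ʳ-fromℕ (x ∷ xs) y = lookup-∷ʳ-fromℕ xs y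

∈-∷ʳ⁺ˡ : {x y : A} {xs : Vec A n} → x ∈ xs → x ∈ xs ∷ʳ y
∈-∷ʳ⁺ˡ (here x≡) = here x≡
∈-∷ʳ⁺ˡ (there x∈) = there (∈-∷ʳ⁺ˡ x∈)

∈-∷ʳ⁺ʳ : (y : A) (xs : Vec A n) → y ∈ xs ∷ʳ y
∈-∷ʳ⁺ʳ y []       = here refl
∈-∷ʳ⁺ʳ y (x ∷ xs) = there (∈-∷ʳ⁺ʳ y xs)

map-inject₁-injective : (u v : Vec (Fin n) m) → map inject₁ u ≡ map inject₁ v → u ≡ v
map-inject₁-injective []      []      _  = refl
map-inject₁-injective (a ∷ u) (b ∷ v) eq =
  cong₂ _∷_ (inject₁-injective (∷-injectiveˡ eq)) (map-inject₁-injective u v (∷-injectiveʳ eq))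

toℕ-≢ : {x y : Fin n} → x ≢ y → toℕ x ≢ toℕ y
toℕ-≢ x≢y = λ eq → x≢y (toℕ-injective eq)

module _ {A : Set} where

  unique-⊆⇒↭ : (xs ys : List A) → Unique xs → Unique ys → xs ⊆ ys → length ys ≤ length xs → xs ↭ ys
  unique-⊆⇒↭ []       []      _ _ _ _ = ↭-refl
  unique-⊆⇒↭ []       (_ ∷ _) _ _ _ ()
  unique-⊆⇒↭ (x ∷ xs) ys (x∉xs ∷ xs-unique) ys-unique xs⊆ys len with ∈-∃++ (xs⊆ys (here refl))
  ... | as , bs , refl =
    ↭-trans (prep x (unique-⊆⇒↭ xs (as ++ bs) xs-unique rest-unique xs⊆rest rest-length)) (↭-sym moved)
    where
    moved : as ++ x ∷ bs ↭ x ∷ as ++ bs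
    moved = shift x as bs
    rest-unique : Unique (as ++ bs)
    rest-unique with ↭ₛ.Unique-resp-↭ (setoid A) (↭⇒↭ₛ moved) ys-unique
    ... | _ ∷ unique = unique
    xs⊆rest : xs ⊆ as ++ bs
    xs⊆rest v∈xs with ∈-resp-↭ moved (xs⊆ys (there v∈xs))
    ... | here refl    = ⊥-elim (All.lookup x∉xs v∈xs refl)
    ... | there v∈rest = v∈rest
    rest-length : length (as ++ bs) ≤ length xs
    rest-length = s≤s⁻¹ (subst (_≤ suc (length xs)) (↭-length moved) len)

  module _ {P Q : A → Set} (P? : Decidable P) (Q? : Decidable Q) where

    filter-×-dec : ∀ xs → filter (λ x → P? x ×-dec Q? x) xs ≡ filter Q? (filter P? xs)
    filter-×-dec []       = refl
    filter-×-dec (x ∷ xs) with P? x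
    ... | no _  = filter-×-dec xs
    ... | yes _ with Q? x
    ...   | yes _ = cong (x ∷_) (filter-×-dec xs)
    ...   | no _  = filter-×-dec xs

    filter-cong-∈ : ∀ xs → (∀ {x} → x ∈ₗ xs → does (P? x) ≡ does (Q? x)) → filter P? xs ≡ filter Q? xs
    filter-cong-∈ []       _     = refl
    filter-cong-∈ (x ∷ xs) P≡Q with P? x | Q? x | P≡Q (here refl)
    ... | yes _ | yes _ | _  = cong (x ∷_) (filter-cong-∈ xs (P≡Q ∘ there))
    ... | no _  | no _  | _  = filter-cong-∈ xs (P≡Q ∘ there)
    ... | yes _ | no _  | ()
    ... | no _  | yes _ | ()

  filter-map : {B : Set} {P : B → Set} (P? : Decidable P) (f : A → B) (xs : List A) →
    filter P? (mapₗ f xs) ≡ mapₗ f (filter (P? ∘ f) xs)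
  filter-map P? f []       = refl
  filter-map P? f (x ∷ xs) with P? (f x)
  ... | yes _ = cong (f x ∷_) (filter-map P? f xs)
  ... | no _  = filter-map P? f xs

  InjectiveOn : {B : Set} → (A → B) → List A → Set
  InjectiveOn f xs = ∀ {x y} → x ∈ₗ xs → y ∈ₗ xs → f x ≡ f y → x ≡ y

  unique-map : {B : Set} (f : A → B) {xs : List A} → Unique xs → InjectiveOn f xs → Unique (mapₗ f xs)
  unique-map f {[]}     []                  _   = []
  unique-map f {x ∷ xs} (x∉xs ∷ xs-unique) inj =
    AllP.map⁺ (All.tabulate (λ y∈xs fx≡fy → All.lookup x∉xs y∈xs (inj (here refl) (there y∈xs) fx≡fy)))
      ∷ unique-map f xs-unique (λ x∈ y∈ → inj (there x∈) (there y∈))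

  length-filter-reindex : {P Q : A → Set} (P? : Decidable P) (Q? : Decidable Q) (f : A → A) (xs : List A) →
    Unique xs → (∀ {x} → x ∈ₗ xs → f x ∈ₗ xs) → InjectiveOn f xs →
    (∀ {x} → x ∈ₗ xs → does (P? x) ≡ does (Q? (f x))) →
    length (filter P? xs) ≡ length (filter Q? xs)
  length-filter-reindex P? Q? f xs xs-unique f-into f-inj P≡Q∘f = begin
    length (filter P? xs)                  ≡⟨ cong length (filter-cong-∈ P? (Q? ∘ f) xs P≡Q∘f) ⟩
    length (filter (Q? ∘ f) xs)            ≡⟨ sym (length-map f (filter (Q? ∘ f) xs)) ⟩
    length (mapₗ f (filter (Q? ∘ f) xs))   ≡⟨ cong length (sym (filter-map Q? f xs)) ⟩
    length (filter Q? (mapₗ f xs))         ≡⟨ ↭-length (filter-↭ Q? f[xs]↭xs) ⟩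
    length (filter Q? xs)                  ∎
    where
    open ≡-Reasoning
    f[xs]↭xs : mapₗ f xs ↭ xs
    f[xs]↭xs = unique-⊆⇒↭ (mapₗ f xs) xs (unique-map f xs-unique f-inj) xs-unique
      (λ fx∈ → let (x , x∈ , y≡fx) = ∈-map⁻ f fx∈ in subst (_∈ₗ xs) (sym y≡fx) (f-into x∈))
      (≤-reflexive (sym (length-map f xs)))

concatMap-map≡cartesianProductWith : {B C : Set} (f : A → B → C) (xs : List A) (ys : List B) →
  concatMap (λ x → mapₗ (f x) ys) xs ≡ cartesianProductWith f xs ys
concatMap-map≡cartesianProductWith f []       ys = refl
concatMap-map≡cartesianProductWith f (x ∷ xs) ys =
  cong (mapₗ (f x) ys ++_) (concatMap-map≡cartesianProductWith f xs ys)

allWords-suc : ∀ n m → allWords n (suc m) ≡ cartesianProductWith _∷_ (allFin n) (allWords n m)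
allWords-suc n m = concatMap-map≡cartesianProductWith _∷_ (allFin n) (allWords n m)

allWords-unique : ∀ n m → Unique (allWords n m)
allWords-unique n zero    = [] ∷ []
allWords-unique n (suc m) rewrite allWords-suc n m =
  Unique.cartesianProductWith⁺ _∷_ ∷-injective (Unique.allFin⁺ n) (allWords-unique n m)

∈-allWords : (w : Vec (Fin n) m) → w ∈ₗ allWords n m
∈-allWords []                    = here refl
∈-allWords {n} {suc m} (x ∷ w) rewrite allWords-suc n m =
  ∈-cartesianProductWith⁺ _∷_ (∈-allFin x) (∈-allWords w)

vals-map-inject₁ : (w : Vec (Fin n) m) → vals (map inject₁ w) ≡ vals w
vals-map-inject₁ []      = refl
vals-map-inject₁ (a ∷ w) = cong₂ _∷_ (toℕ-inject₁ a) (vals-map-inject₁ w)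

vals-∷ʳ : (w : Vec (Fin n) m) (a : Fin n) → vals (w ∷ʳ a) ≡ vals w ++ [ toℕ a ]
vals-∷ʳ []      a = refl
vals-∷ʳ (b ∷ w) a = cong (toℕ b ∷_) (vals-∷ʳ w a)

length-vals : (w : Vec (Fin n) m) → length (vals w) ≡ m
length-vals []      = refl
length-vals (a ∷ w) = cong suc (length-vals w)

-- A weight f i p scores the value p at position i (excedances), or the letter p followed by the
-- letter i (descents). At top level the start value 0 of desSumFrom stands for "no letter".
Vanishing : (ℕ → ℕ → ℕ) → Set
Vanishing f = ∀ {i p} → p ≤ i → f i p ≡ 0

excSumFrom : (ℕ → ℕ → ℕ) → ℕ → List ℕ → ℕ
excSumFrom f i []       = 0
excSumFrom f i (p ∷ ps) = f i p + excSumFrom f (suc i) ps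

desSumFrom : (ℕ → ℕ → ℕ) → ℕ → List ℕ → ℕ
desSumFrom f a []       = 0
desSumFrom f a (p ∷ ps) = f p a + desSumFrom f p ps

excSum desSum : (ℕ → ℕ → ℕ) → Vec (Fin n) m → ℕ
excSum f w = excSumFrom f 0 (vals w)
desSum f w = desSumFrom f 0 (vals w)

module _ (f : ℕ → ℕ → ℕ) where

  excSumFrom-++ : ∀ i xs ys → excSumFrom f i (xs ++ ys) ≡ excSumFrom f i xs + excSumFrom f (i + length xs) ys
  excSumFrom-++ i []       ys rewrite +-identityʳ i = refl
  excSumFrom-++ i (x ∷ xs) ys rewrite excSumFrom-++ (suc i) xs ys | +-suc i (length xs) =
    sym (+-assoc (f i x) _ _)

  excSum-∷ʳ : (w : Vec (Fin k) m) (a : Fin k) → excSum f (w ∷ʳ a) ≡ excSum f w + f m (toℕ a)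
  excSum-∷ʳ {m = m} w a
    rewrite vals-∷ʳ w a | excSumFrom-++ 0 (vals w) [ toℕ a ] | length-vals w | +-identityʳ (f m (toℕ a)) = refl

  excSumFrom-update : ∀ i (v : Vec (Fin k) m) x (a : Fin k) →
    excSumFrom f i (vals (v [ x ]≔ a)) + f (i + toℕ x) (toℕ (lookup v x))
      ≡ excSumFrom f i (vals v) + f (i + toℕ x) (toℕ a)
  excSumFrom-update i (b ∷ v) zero    a rewrite +-identityʳ i = [x+y]+z≡[z+y]+x (f i (toℕ a)) _ _
  excSumFrom-update i (b ∷ v) (suc x) a rewrite +-suc i (toℕ x) =
    +-assoc-congʳ (f i (toℕ b)) (excSumFrom-update (suc i) v x a)

ifAbove : (ℕ → ℕ → ℕ) → ℕ → ℕ → ℕ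
ifAbove g i p = if i <ᵇ p then g i p else 0

ifAbove-vanishing : ∀ g → Vanishing (ifAbove g)
ifAbove-vanishing g {i} {p} p≤i with i <ᵇ p in i<ᵇp
... | false = refl
... | true  = ⊥-elim (≤⇒≯ p≤i (<ᵇ⇒< i p (subst T (sym i<ᵇp) tt)))

above surplus : ℕ → ℕ → ℕ
above = ifAbove (λ _ _ → 1)
surplus = ifAbove (λ i p → p ∸ i)

excAux≡excSumFrom : ∀ i ps → excAux i ps ≡ excSumFrom above i ps
excAux≡excSumFrom i []       = refl
excAux≡excSumFrom i (p ∷ ps) = cong (above i p +_) (excAux≡excSumFrom (suc i) ps)

dexcAux≡excSumFrom : ∀ i ps → dexcAux i ps ≡ excSumFrom surplus i ps
dexcAux≡excSumFrom i []       = refl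
dexcAux≡excSumFrom i (p ∷ ps) = cong (surplus i p +_) (dexcAux≡excSumFrom (suc i) ps)

desAux≡desSumFrom : ∀ p ps → desAux (p ∷ ps) ≡ desSumFrom above p ps
desAux≡desSumFrom p []       = refl
desAux≡desSumFrom p (q ∷ ps) = cong (above q p +_) (desAux≡desSumFrom q ps)

ddesAux≡desSumFrom : ∀ p ps → ddesAux (p ∷ ps) ≡ desSumFrom surplus p ps
ddesAux≡desSumFrom p []       = refl
ddesAux≡desSumFrom p (q ∷ ps) = cong (surplus q p +_) (ddesAux≡desSumFrom q ps)

des≡desSum : (w : Word n) → des w ≡ desSum above w
des≡desSum w with vals w
... | []     = refl
... | p ∷ ps = desAux≡desSumFrom p ps

ddes≡desSum : (w : Word n) → ddes w ≡ desSum surplus w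
ddes≡desSum w with vals w
... | []     = refl
... | p ∷ ps = ddesAux≡desSumFrom p ps

IsOnto : Vec (Fin n) m → Set
IsOnto {n} w = (x : Fin n) → x ∈ w

onto⇒isPerm : (w : Word n) → IsOnto w → IsPerm w
onto⇒isPerm {n} w onto i j wᵢ≡wⱼ = begin
  i                     ≡⟨ sym (position-lookup i) ⟩
  position (lookup w i) ≡⟨ cong position wᵢ≡wⱼ ⟩
  position (lookup w j) ≡⟨ position-lookup j ⟩
  j                     ∎
  where
  open ≡-Reasoning
  position : Fin n → Fin n
  position x = Anyᵥ.index (onto x)
  lookup-position : ∀ x → lookup w (position x) ≡ x
  lookup-position x = sym (lookup-index (onto x))
  position-injective : ∀ x y → position x ≡ position y → x ≡ y
  position-injective x y eq = begin
    x                     ≡⟨ sym (lookup-position x) ⟩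
    lookup w (position x) ≡⟨ cong (lookup w) eq ⟩
    lookup w (position y) ≡⟨ lookup-position y ⟩
    y                     ∎
  position-lookup : ∀ i → position (lookup w i) ≡ i
  position-lookup i with injective⇒surjective position position-injective i
  ... | a , refl = cong position (lookup-position a)

-- Insert the new letter n into the cycle of σ right after x, or as a fixed point.
cycleInsert : Maybe (Fin n) → Word n → Word (suc n)
cycleInsert {n} nothing  σ = map inject₁ σ ∷ʳ fromℕ n
cycleInsert {n} (just x) σ = (map inject₁ σ [ x ]≔ fromℕ n) ∷ʳ inject₁ (lookup σ x)

module _ (σ : Word n) where

  lookup-cycleInsert-nothing-inject₁ : ∀ i → lookup (cycleInsert nothing σ) (inject₁ i) ≡ inject₁ (lookup σ i)
  lookup-cycleInsert-nothing-inject₁ i =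
    trans (lookup-∷ʳ-inject₁ (map inject₁ σ) (fromℕ n) i) (lookup-map i inject₁ σ)

  lookup-cycleInsert-nothing-fromℕ : lookup (cycleInsert nothing σ) (fromℕ n) ≡ fromℕ n
  lookup-cycleInsert-nothing-fromℕ = lookup-∷ʳ-fromℕ (map inject₁ σ) (fromℕ n)

  module _ (x : Fin n) where

    lookup-cycleInsert-just-fromℕ : lookup (cycleInsert (just x) σ) (fromℕ n) ≡ inject₁ (lookup σ x)
    lookup-cycleInsert-just-fromℕ = lookup-∷ʳ-fromℕ (map inject₁ σ [ x ]≔ fromℕ n) _

    lookup-cycleInsert-just-target : lookup (cycleInsert (just x) σ) (inject₁ x) ≡ fromℕ n
    lookup-cycleInsert-just-target =
      trans (lookup-∷ʳ-inject₁ (map inject₁ σ [ x ]≔ fromℕ n) (inject₁ (lookup σ x)) x)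
            (lookup∘update x (map inject₁ σ) (fromℕ n))

    lookup-cycleInsert-just-other : ∀ {i} → x ≢ i →
      lookup (cycleInsert (just x) σ) (inject₁ i) ≡ inject₁ (lookup σ i)
    lookup-cycleInsert-just-other {i} x≢i = begin
      lookup (cycleInsert (just x) σ) (inject₁ i)   ≡⟨ lookup-∷ʳ-inject₁ σ′ (inject₁ (lookup σ x)) i ⟩
      lookup σ′ i                                   ≡⟨ lookup∘update′ (≢-sym x≢i) (map inject₁ σ) _ ⟩
      lookup (map inject₁ σ) i                      ≡⟨ lookup-map i inject₁ σ ⟩
      inject₁ (lookup σ i)                          ∎
      where
      open ≡-Reasoning
      σ′ = map inject₁ σ [ x ]≔ fromℕ n

maxPreimage : Word (suc n) → Maybe (Fin n)
maxPreimage {n} σ with any? (λ i → lookup σ (inject₁ i) ≟ᶠ fromℕ n)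
... | yes (i , _) = just i
... | no _        = nothing

data MaxPreimage (σ : Word (suc n)) : Maybe (Fin n) → Set where
  at    : ∀ x → lookup σ (inject₁ x) ≡ fromℕ n → MaxPreimage σ (just x)
  fixed : (∀ i → lookup σ (inject₁ i) ≢ fromℕ n) → MaxPreimage σ nothing

maxPreimage-view : (σ : Word (suc n)) → MaxPreimage σ (maxPreimage σ)
maxPreimage-view {n} σ with any? (λ i → lookup σ (inject₁ i) ≟ᶠ fromℕ n)
... | yes (x , σx≡n) = at x σx≡n
... | no miss         = fixed (λ i σi≡n → miss (i , σi≡n))

-- σ with n cut out of its cycle, before lowering the values to Fin n.
bypassMax : Word (suc n) → Maybe (Fin n) → Fin n → Fin (suc n)
bypassMax σ nothing i = lookup σ (inject₁ i)
bypassMax {n} σ (just x) i with x ≟ᶠ i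
... | yes _ = lookup σ (fromℕ n)
... | no _  = lookup σ (inject₁ i)

-- The default d is a junk value: removeMax never lowers fromℕ n.
lowerOr : Fin n → Fin (suc n) → Fin n
lowerOr {n} d j with n ≟ toℕ j
... | yes _   = d
... | no n≢j  = lower₁ j n≢j

removeMax : Word (suc n) → Word n
removeMax σ = tabulate (λ i → lowerOr i (bypassMax σ (maxPreimage σ) i))

inject₁-lowerOr : (d : Fin n) (j : Fin (suc n)) → j ≢ fromℕ n → inject₁ (lowerOr d j) ≡ j
inject₁-lowerOr {n} d j j≢n with n ≟ toℕ j
... | yes n≡j = ⊥-elim (j≢n (toℕ-injective (trans (sym n≡j) (sym (toℕ-fromℕ n)))))
... | no n≢j  = inject₁-lower₁ j n≢j

bypassMax-target : (σ : Word (suc n)) (x : Fin n) → bypassMax σ (just x) x ≡ lookup σ (fromℕ n)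
bypassMax-target σ x with x ≟ᶠ x
... | yes _   = refl
... | no x≢x  = ⊥-elim (x≢x refl)

bypassMax-other : (σ : Word (suc n)) {x i : Fin n} → x ≢ i → bypassMax σ (just x) i ≡ lookup σ (inject₁ i)
bypassMax-other σ {x} {i} x≢i with x ≟ᶠ i
... | yes x≡i = ⊥-elim (x≢i x≡i)
... | no _    = refl

module _ {σ : Word (suc n)} (σ-perm : IsPerm σ) where

  bypassMax-≢-fromℕ : ∀ {c} → MaxPreimage σ c → ∀ i → bypassMax σ c i ≢ fromℕ n
  bypassMax-≢-fromℕ (fixed miss) i = miss i
  bypassMax-≢-fromℕ (at x σx≡n) i σ′i≡n with x ≟ᶠ i
  ... | yes refl = fromℕ≢inject₁ (σ-perm (fromℕ n) (inject₁ x) (trans σ′i≡n (sym σx≡n)))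
  ... | no x≢i   = x≢i (inject₁-injective (σ-perm (inject₁ x) (inject₁ i) (trans σx≡n (sym σ′i≡n))))

  inject₁-removeMax : ∀ i → inject₁ (lookup (removeMax σ) i) ≡ bypassMax σ (maxPreimage σ) i
  inject₁-removeMax i rewrite lookup∘tabulate (λ i → lowerOr i (bypassMax σ (maxPreimage σ) i)) i =
    inject₁-lowerOr i _ (bypassMax-≢-fromℕ (maxPreimage-view σ) i)

  bypassMax-injective : ∀ {c} → MaxPreimage σ c → ∀ i j → bypassMax σ c i ≡ bypassMax σ c j → i ≡ j
  bypassMax-injective (fixed _) i j eq = inject₁-injective (σ-perm _ _ eq)
  bypassMax-injective (at x _) i j eq with x ≟ᶠ i | x ≟ᶠ j
  ... | yes refl | yes refl = refl
  ... | yes refl | no _     = ⊥-elim (fromℕ≢inject₁ (σ-perm _ _ eq))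
  ... | no _     | yes refl = ⊥-elim (fromℕ≢inject₁ (sym (σ-perm _ _ eq)))
  ... | no _     | no _     = inject₁-injective (σ-perm _ _ eq)

  removeMax-isPerm : IsPerm (removeMax σ)
  removeMax-isPerm i j eq = bypassMax-injective (maxPreimage-view σ) i j (begin
    bypassMax σ (maxPreimage σ) i    ≡⟨ sym (inject₁-removeMax i) ⟩
    inject₁ (lookup (removeMax σ) i) ≡⟨ cong inject₁ eq ⟩
    inject₁ (lookup (removeMax σ) j) ≡⟨ inject₁-removeMax j ⟩
    bypassMax σ (maxPreimage σ) j    ∎)
    where open ≡-Reasoning

  fromℕ-fixed : (∀ i → lookup σ (inject₁ i) ≢ fromℕ n) → lookup σ (fromℕ n) ≡ fromℕ n
  fromℕ-fixed miss with injective⇒surjective (lookup σ) σ-perm (fromℕ n)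
  ... | j , σj≡n with view j
  ...   | ‵fromℕ     = σj≡n
  ...   | ‵inject₁ i = ⊥-elim (miss i σj≡n)

  cycleInsert-removeMax : cycleInsert (maxPreimage σ) (removeMax σ) ≡ σ
  cycleInsert-removeMax = lookup-extensional _ _ (agrees (maxPreimage-view σ) inject₁-removeMax)
    where
    σ₀ = removeMax σ
    agrees : ∀ {c} → MaxPreimage σ c → (∀ i → inject₁ (lookup σ₀ i) ≡ bypassMax σ c i) →
             ∀ j → lookup (cycleInsert c σ₀) j ≡ lookup σ j
    agrees (fixed miss) σ₀≈ j with view j
    ... | ‵fromℕ     = trans (lookup-cycleInsert-nothing-fromℕ σ₀) (sym (fromℕ-fixed miss))
    ... | ‵inject₁ i = trans (lookup-cycleInsert-nothing-inject₁ σ₀ i) (σ₀≈ i)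
    agrees (at x σx≡n) σ₀≈ j with view j
    ... | ‵fromℕ = trans (lookup-cycleInsert-just-fromℕ σ₀ x) (trans (σ₀≈ x) (bypassMax-target σ x))
    ... | ‵inject₁ i with x ≟ᶠ i
    ...   | yes refl = trans (lookup-cycleInsert-just-target σ₀ x) (sym σx≡n)
    ...   | no x≢i   =
      trans (lookup-cycleInsert-just-other σ₀ x x≢i) (trans (σ₀≈ i) (bypassMax-other σ x≢i))

module _ {f : ℕ → ℕ → ℕ} (f-vanishing : Vanishing f) where

  excSum-cycleInsert-nothing : (σ : Word n) → excSum f (cycleInsert nothing σ) ≡ excSum f σ
  excSum-cycleInsert-nothing {n} σ = begin
    excSum f (map inject₁ σ ∷ʳ fromℕ n)             ≡⟨ excSum-∷ʳ f (map inject₁ σ) (fromℕ n) ⟩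
    excSum f (map inject₁ σ) + f n (toℕ (fromℕ n))  ≡⟨ cong₂ _+_ (cong (excSumFrom f 0) (vals-map-inject₁ σ))
                                                               (f-vanishing (≤-reflexive (toℕ-fromℕ n))) ⟩
    excSum f σ + 0                                  ≡⟨ +-identityʳ _ ⟩
    excSum f σ                                      ∎
    where open ≡-Reasoning

  excSum-cycleInsert-just : (σ : Word n) (x : Fin n) →
    excSum f (cycleInsert (just x) σ) + f (toℕ x) (toℕ (lookup σ x)) ≡ excSum f σ + f (toℕ x) n
  excSum-cycleInsert-just {n} σ x = begin
    excSum f (σ′ ∷ʳ inject₁ σx) + f (toℕ x) (toℕ σx)
      ≡⟨ cong (_+ f (toℕ x) (toℕ σx)) (excSum-∷ʳ f σ′ (inject₁ σx)) ⟩
    (excSum f σ′ + f n (toℕ (inject₁ σx))) + f (toℕ x) (toℕ σx)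
      ≡⟨ cong (λ t → (excSum f σ′ + t) + f (toℕ x) (toℕ σx)) (f-vanishing σx≤n) ⟩
    (excSum f σ′ + 0) + f (toℕ x) (toℕ σx)
      ≡⟨ cong₂ _+_ (+-identityʳ _) (cong (f (toℕ x)) (sym toℕ-lookup-map)) ⟩
    excSum f σ′ + f (toℕ x) (toℕ (lookup (map inject₁ σ) x))
      ≡⟨ excSumFrom-update f 0 (map inject₁ σ) x (fromℕ n) ⟩
    excSum f (map inject₁ σ) + f (toℕ x) (toℕ (fromℕ n))
      ≡⟨ cong₂ _+_ (cong (excSumFrom f 0) (vals-map-inject₁ σ)) (cong (f (toℕ x)) (toℕ-fromℕ n)) ⟩
    excSum f σ + f (toℕ x) n
      ∎
    where
    open ≡-Reasoning
    σx = lookup σ x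
    σ′ = map inject₁ σ [ x ]≔ fromℕ n
    σx≤n : toℕ (inject₁ σx) ≤ n
    σx≤n = <⇒≤ (subst (_< n) (sym (toℕ-inject₁ σx)) (toℕ<n σx))
    toℕ-lookup-map : toℕ (lookup (map inject₁ σ) x) ≡ toℕ σx
    toℕ-lookup-map = trans (cong toℕ (lookup-map x inject₁ σ)) (toℕ-inject₁ σx)

wordInsert : Maybe (Fin n) → Vec (Fin n) m → Vec (Fin (suc n)) (suc m)
wordInsert {n} nothing  w        = map inject₁ w ∷ʳ fromℕ n
wordInsert {n} (just y) []       = fromℕ n ∷ []
wordInsert {n} (just y) (a ∷ w) with a ≟ᶠ y
... | yes _ = fromℕ n ∷ inject₁ a ∷ map inject₁ w
... | no _  = inject₁ a ∷ wordInsert (just y) w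

fromℕ-∈-wordInsert : (c : Maybe (Fin n)) (w : Vec (Fin n) m) → fromℕ n ∈ wordInsert c w
fromℕ-∈-wordInsert nothing  w       = ∈-∷ʳ⁺ʳ _ (map inject₁ w)
fromℕ-∈-wordInsert (just y) []      = here refl
fromℕ-∈-wordInsert (just y) (a ∷ w) with a ≟ᶠ y
... | yes _ = here refl
... | no _  = there (fromℕ-∈-wordInsert (just y) w)

inject₁-∈-wordInsert : (c : Maybe (Fin n)) {w : Vec (Fin n) m} {x : Fin n} →
  x ∈ w → inject₁ x ∈ wordInsert c w
inject₁-∈-wordInsert nothing x∈w = ∈-∷ʳ⁺ˡ (∈-map⁺ inject₁ x∈w)
inject₁-∈-wordInsert (just y) {a ∷ w} x∈w with a ≟ᶠ y | x∈w
... | yes _ | here refl  = there (here refl)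
... | yes _ | there x∈   = there (there (∈-map⁺ inject₁ x∈))
... | no _  | here refl  = here refl
... | no _  | there x∈   = there (inject₁-∈-wordInsert (just y) x∈)

wordInsert-onto : (c : Maybe (Fin n)) {w : Vec (Fin n) m} → IsOnto w → IsOnto (wordInsert c w)
wordInsert-onto c {w} onto x with view x
... | ‵fromℕ     = fromℕ-∈-wordInsert c w
... | ‵inject₁ i = inject₁-∈-wordInsert c (onto i)

wordInsert-just≢nothing : {y : Fin n} {w v : Vec (Fin n) m} → y ∈ w → wordInsert (just y) w ≢ wordInsert nothing v
wordInsert-just≢nothing {y = y} {a ∷ w} {b ∷ v} y∈ eq with a ≟ᶠ y | y∈
... | yes _ | _          = fromℕ≢inject₁ (∷-injectiveˡ eq)
... | no a≢y | here refl = a≢y refl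
... | no _ | there y∈w   = wordInsert-just≢nothing y∈w (∷-injectiveʳ eq)

wordInsert-injective : {c d : Maybe (Fin n)} {w v : Vec (Fin n) m} → Maybe.All (_∈ w) c → Maybe.All (_∈ v) d →
  wordInsert c w ≡ wordInsert d v → c ≡ d × w ≡ v
wordInsert-injective {w = w} {v} nothing nothing eq =
  refl , map-inject₁-injective w v (proj₁ (∷ʳ-injective _ _ eq))
wordInsert-injective (just y∈w) nothing eq = ⊥-elim (wordInsert-just≢nothing y∈w eq)
wordInsert-injective nothing (just z∈v) eq = ⊥-elim (wordInsert-just≢nothing z∈v (sym eq))
wordInsert-injective {c = just y} {just z} {a ∷ w} {b ∷ v} (just y∈) (just z∈) eq
  with a ≟ᶠ y | b ≟ᶠ z | y∈ | z∈
... | yes refl | yes refl | _ | _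
  with inject₁-injective (∷-injectiveˡ (∷-injectiveʳ eq))
...   | refl = refl , cong (a ∷_) (map-inject₁-injective w v (∷-injectiveʳ (∷-injectiveʳ eq)))
wordInsert-injective _ _ eq | yes _ | no _ | _ | _ = ⊥-elim (fromℕ≢inject₁ (∷-injectiveˡ eq))
wordInsert-injective _ _ eq | no _ | yes _ | _ | _ = ⊥-elim (fromℕ≢inject₁ (sym (∷-injectiveˡ eq)))
wordInsert-injective _ _ eq | no a≢y | no _ | here refl | _ = ⊥-elim (a≢y refl)
wordInsert-injective _ _ eq | no _ | no b≢z | there _ | here refl = ⊥-elim (b≢z refl)
wordInsert-injective _ _ eq | no _ | no _ | there y∈w | there z∈v
  with inject₁-injective (∷-injectiveˡ eq) | wordInsert-injective (just y∈w) (just z∈v) (∷-injectiveʳ eq)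
...   | refl | refl , refl = refl , refl

vals-wordInsert-nothing : (w : Vec (Fin n) m) → vals (wordInsert nothing w) ≡ vals w ++ [ n ]
vals-wordInsert-nothing {n} w
  rewrite vals-∷ʳ (map inject₁ w) (fromℕ n) | vals-map-inject₁ w | toℕ-fromℕ n = refl

-- The letter preceding the first x in a ∷ ps (0 if x does not occur); as in desSumFrom, a = 0
-- stands for "no letter", which no vanishing weight counts.
valueBefore : ℕ → ℕ → List ℕ → ℕ
valueBefore a x []       = 0
valueBefore a x (p ∷ ps) with p ≟ x
... | yes _ = a
... | no _  = valueBefore p x ps

valueBefore-here : ∀ a x ps → valueBefore a x (x ∷ ps) ≡ a
valueBefore-here a x ps with x ≟ x
... | yes _  = refl
... | no x≢x = ⊥-elim (x≢x refl)

valueBefore-there : ∀ a {x p} ps → p ≢ x → valueBefore a x (p ∷ ps) ≡ valueBefore p x ps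
valueBefore-there a {x} {p} ps p≢x with p ≟ x
... | yes p≡x = ⊥-elim (p≢x p≡x)
... | no _    = refl

valueBefore-∷ʳ : ∀ a {x q} ps → q ≢ x → valueBefore a x (ps ++ [ q ]) ≡ valueBefore a x ps
valueBefore-∷ʳ a []       q≢x = valueBefore-there a [] q≢x
valueBefore-∷ʳ a {x} (p ∷ ps) q≢x with p ≟ x
... | yes _ = refl
... | no _  = valueBefore-∷ʳ p ps q≢x

valueBefore-++-max-≤ : ∀ {a} → a ≤ n → (w : Vec (Fin n) m) → valueBefore a n (vals w ++ [ n ]) ≤ n
valueBefore-++-max-≤ {n} {a = a} a≤n [] = subst (_≤ n) (sym (valueBefore-here a n [])) a≤n
valueBefore-++-max-≤ {n} {a = a} a≤n (b ∷ w) =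
  subst (_≤ n) (sym (valueBefore-there a (vals w ++ [ n ]) (<⇒≢ (toℕ<n b))))
    (valueBefore-++-max-≤ (<⇒≤ (toℕ<n b)) w)

module _ {y : Fin n} where

  valueBefore-wordInsert-other : ∀ a {x : Fin n} (w : Vec (Fin n) m) → x ≢ y →
    valueBefore a (toℕ x) (vals (wordInsert (just y) w)) ≡ valueBefore a (toℕ x) (vals w)
  valueBefore-wordInsert-other a {x} [] x≢y rewrite toℕ-fromℕ n =
    valueBefore-there a [] (>⇒≢ (toℕ<n x))
  valueBefore-wordInsert-other a {x} (b ∷ w) x≢y with b ≟ᶠ y
  ... | yes refl rewrite toℕ-fromℕ n | toℕ-inject₁ b | vals-map-inject₁ w = begin
    valueBefore a (toℕ x) (n ∷ toℕ b ∷ vals w) ≡⟨ valueBefore-there a _ (>⇒≢ (toℕ<n x)) ⟩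
    valueBefore n (toℕ x) (toℕ b ∷ vals w)     ≡⟨ valueBefore-there n _ b≢x ⟩
    valueBefore (toℕ b) (toℕ x) (vals w)       ≡⟨ sym (valueBefore-there a _ b≢x) ⟩
    valueBefore a (toℕ x) (toℕ b ∷ vals w)     ∎
    where
    open ≡-Reasoning
    b≢x = toℕ-≢ (≢-sym x≢y)
  ... | no _ rewrite toℕ-inject₁ b with toℕ b ≟ toℕ x
  ...   | yes _ = refl
  ...   | no _  = valueBefore-wordInsert-other (toℕ b) w x≢y

  valueBefore-wordInsert-fromℕ : ∀ a (w : Vec (Fin n) m) → y ∈ w →
    valueBefore a n (vals (wordInsert (just y) w)) ≡ valueBefore a (toℕ y) (vals w)
  valueBefore-wordInsert-fromℕ a (b ∷ w) y∈ with b ≟ᶠ y | y∈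
  ... | yes refl | _ rewrite toℕ-fromℕ n =
    trans (valueBefore-here a n _) (sym (valueBefore-here a (toℕ b) (vals w)))
  ... | no b≢y | here refl = ⊥-elim (b≢y refl)
  ... | no b≢y | there y∈w rewrite toℕ-inject₁ b = begin
    valueBefore a n (toℕ b ∷ vals (wordInsert (just y) w)) ≡⟨ valueBefore-there a _ (<⇒≢ (toℕ<n b)) ⟩
    valueBefore (toℕ b) n (vals (wordInsert (just y) w))   ≡⟨ valueBefore-wordInsert-fromℕ (toℕ b) w y∈w ⟩
    valueBefore (toℕ b) (toℕ y) (vals w)                    ≡⟨ sym (valueBefore-there a _ (toℕ-≢ b≢y)) ⟩
    valueBefore a (toℕ y) (toℕ b ∷ vals w)                  ∎
    where open ≡-Reasoning

  valueBefore-wordInsert-target : ∀ a (w : Vec (Fin n) m) → y ∈ w →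
    valueBefore a (toℕ y) (vals (wordInsert (just y) w)) ≡ n
  valueBefore-wordInsert-target a (b ∷ w) y∈ with b ≟ᶠ y | y∈
  ... | yes refl | _ rewrite toℕ-fromℕ n | toℕ-inject₁ b = begin
    valueBefore a (toℕ b) (n ∷ toℕ b ∷ _) ≡⟨ valueBefore-there a _ (>⇒≢ (toℕ<n b)) ⟩
    valueBefore n (toℕ b) (toℕ b ∷ _)     ≡⟨ valueBefore-here n (toℕ b) _ ⟩
    n                                     ∎
    where open ≡-Reasoning
  ... | no b≢y | here refl = ⊥-elim (b≢y refl)
  ... | no b≢y | there y∈w rewrite toℕ-inject₁ b =
    trans (valueBefore-there a _ (toℕ-≢ b≢y)) (valueBefore-wordInsert-target (toℕ b) w y∈w)

module _ {f : ℕ → ℕ → ℕ} (f-vanishing : Vanishing f) where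

  desSumFrom-++-max : ∀ {a} → a ≤ n → (w : Vec (Fin n) m) →
    desSumFrom f a (vals w ++ [ n ]) ≡ desSumFrom f a (vals w)
  desSumFrom-++-max a≤n []      = trans (+-identityʳ _) (f-vanishing a≤n)
  desSumFrom-++-max {a = a} a≤n (b ∷ w) = cong (f (toℕ b) a +_) (desSumFrom-++-max (<⇒≤ (toℕ<n b)) w)

  desSumFrom-wordInsert-nothing : ∀ {a} → a ≤ n → (w : Vec (Fin n) m) →
    desSumFrom f a (vals (wordInsert nothing w)) ≡ desSumFrom f a (vals w)
  desSumFrom-wordInsert-nothing {a = a} a≤n w =
    trans (cong (desSumFrom f a) (vals-wordInsert-nothing w)) (desSumFrom-++-max a≤n w)

  desSumFrom-wordInsert-just : ∀ {a} → a ≤ n → {y : Fin n} (w : Vec (Fin n) m) → y ∈ w →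
    desSumFrom f a (vals (wordInsert (just y) w)) + f (toℕ y) (valueBefore a (toℕ y) (vals w))
      ≡ desSumFrom f a (vals w) + f (toℕ y) n
  desSumFrom-wordInsert-just {n} {a = a} a≤n {y} (b ∷ w) y∈ with b ≟ᶠ y | y∈
  ... | yes refl | _ rewrite toℕ-fromℕ n | toℕ-inject₁ b | vals-map-inject₁ w
                           | valueBefore-here a (toℕ b) (vals w) | f-vanishing a≤n =
    [x+y]+z≡[z+y]+x (f (toℕ b) n) _ _
  ... | no b≢y | here refl = ⊥-elim (b≢y refl)
  ... | no b≢y | there y∈w rewrite toℕ-inject₁ b | valueBefore-there a (vals w) (toℕ-≢ b≢y) =
    +-assoc-congʳ (f (toℕ b) a) (desSumFrom-wordInsert-just (<⇒≤ (toℕ<n b)) w y∈w)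

Compatible : ℕ → ℕ → ℕ → Set
Compatible s x p = s ≡ p ⊎ (s ≤ x × p ≤ x)

compatible-weaken : ∀ {s x x′ p} → x ≤ x′ → Compatible s x p → Compatible s x′ p
compatible-weaken _    (inj₁ s≡p)         = inj₁ s≡p
compatible-weaken x≤x′ (inj₂ (s≤x , p≤x)) = inj₂ (≤-trans s≤x x≤x′ , ≤-trans p≤x x≤x′)

compatible-weight : ∀ {f} → Vanishing f → ∀ {s x p} → Compatible s x p → f x s ≡ f x p
compatible-weight _           (inj₁ refl)        = refl
compatible-weight f-vanishing (inj₂ (s≤x , p≤x)) = trans (f-vanishing s≤x) (sym (f-vanishing p≤x))

record Corresponds (σ w : Word n) : Set where
  field
    onto       : IsOnto w
    compatible : ∀ x → Compatible (toℕ (lookup σ x)) (toℕ x) (valueBefore 0 (toℕ x) (vals w))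
    sums       : ∀ {f} → Vanishing f → excSum f σ ≡ desSum f w

module _ {σ w : Word n} (σ∼w : Corresponds σ w) where
  open Corresponds σ∼w

  compatible-insert : ∀ c x → Compatible (toℕ (lookup (cycleInsert c σ) x)) (toℕ x)
                                         (valueBefore 0 (toℕ x) (vals (wordInsert c w)))
  compatible-insert nothing x with view x
  ... | ‵fromℕ rewrite lookup-cycleInsert-nothing-fromℕ σ | toℕ-fromℕ n | vals-wordInsert-nothing w =
    inj₂ (≤-refl , valueBefore-++-max-≤ z≤n w)
  ... | ‵inject₁ i rewrite lookup-cycleInsert-nothing-inject₁ σ i | toℕ-inject₁ (lookup σ i) | toℕ-inject₁ i
                         | vals-wordInsert-nothing w | valueBefore-∷ʳ 0 (vals w) (>⇒≢ (toℕ<n i)) =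
    compatible i
  compatible-insert (just y) x with view x
  ... | ‵fromℕ rewrite lookup-cycleInsert-just-fromℕ σ y | toℕ-inject₁ (lookup σ y) | toℕ-fromℕ n
                     | valueBefore-wordInsert-fromℕ 0 w (onto y) =
    compatible-weaken (<⇒≤ (toℕ<n y)) (compatible y)
  ... | ‵inject₁ i with y ≟ᶠ i
  ...   | yes refl rewrite lookup-cycleInsert-just-target σ y | toℕ-fromℕ n | toℕ-inject₁ y
                         | valueBefore-wordInsert-target 0 w (onto y) =
    inj₁ refl
  ...   | no y≢i rewrite lookup-cycleInsert-just-other σ y y≢i | toℕ-inject₁ (lookup σ i) | toℕ-inject₁ i
                       | valueBefore-wordInsert-other 0 w (≢-sym y≢i) =
    compatible i

  sums-insert : ∀ c {f} → Vanishing f → excSum f (cycleInsert c σ) ≡ desSum f (wordInsert c w)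
  sums-insert nothing f-vanishing =
    trans (excSum-cycleInsert-nothing f-vanishing σ)
          (trans (sums f-vanishing) (sym (desSumFrom-wordInsert-nothing f-vanishing z≤n w)))
  sums-insert (just y) {f} f-vanishing = +-cancelʳ-≡ _ _ _ (begin
    excSum f (cycleInsert (just y) σ) + f (toℕ y) (toℕ (lookup σ y))
      ≡⟨ excSum-cycleInsert-just f-vanishing σ y ⟩
    excSum f σ + f (toℕ y) n
      ≡⟨ cong (_+ f (toℕ y) n) (sums f-vanishing) ⟩
    desSum f w + f (toℕ y) n
      ≡⟨ sym (desSumFrom-wordInsert-just f-vanishing z≤n w (onto y)) ⟩
    desSum f (wordInsert (just y) w) + f (toℕ y) (valueBefore 0 (toℕ y) (vals w))
      ≡⟨ cong (desSum f (wordInsert (just y) w) +_) (sym (compatible-weight f-vanishing (compatible y))) ⟩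
    desSum f (wordInsert (just y) w) + f (toℕ y) (toℕ (lookup σ y))
      ∎)
    where open ≡-Reasoning

  corresponds-insert : ∀ c → Corresponds (cycleInsert c σ) (wordInsert c w)
  corresponds-insert c = record
    { onto       = wordInsert-onto c onto
    ; compatible = compatible-insert c
    ; sums       = sums-insert c
    }

excToDes : Word n → Word n
excToDes {zero}  w = w
excToDes {suc n} σ = wordInsert (maxPreimage σ) (excToDes (removeMax σ))

corresponds : (σ : Word n) → IsPerm σ → Corresponds σ (excToDes σ)
corresponds {zero}  [] _ = record { onto = λ (); compatible = λ (); sums = λ _ → refl }
corresponds {suc n} σ σ-perm = subst (λ τ → Corresponds τ (excToDes σ)) (cycleInsert-removeMax σ-perm)
  (corresponds-insert (corresponds (removeMax σ) (removeMax-isPerm σ-perm)) (maxPreimage σ))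

excToDes-isPerm : (σ : Word n) → IsPerm σ → IsPerm (excToDes σ)
excToDes-isPerm σ σ-perm = onto⇒isPerm (excToDes σ) (Corresponds.onto (corresponds σ σ-perm))

onto⇒∈ : {w : Vec (Fin n) m} → IsOnto w → (c : Maybe (Fin n)) → Maybe.All (_∈ w) c
onto⇒∈ onto nothing  = nothing
onto⇒∈ onto (just y) = just (onto y)

excToDes-injective : (σ τ : Word n) → IsPerm σ → IsPerm τ → excToDes σ ≡ excToDes τ → σ ≡ τ
excToDes-injective {zero}  [] [] _ _ _ = refl
excToDes-injective {suc n} σ τ σ-perm τ-perm eq =
  let (c≡d , images≡) = wordInsert-injective (onto⇒∈ (onto σ₀-perm) (maxPreimage σ))
                                             (onto⇒∈ (onto τ₀-perm) (maxPreimage τ)) eq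
  in begin
    σ                                         ≡⟨ sym (cycleInsert-removeMax σ-perm) ⟩
    cycleInsert (maxPreimage σ) (removeMax σ) ≡⟨ cong₂ cycleInsert c≡d
                                                   (excToDes-injective _ _ σ₀-perm τ₀-perm images≡) ⟩
    cycleInsert (maxPreimage τ) (removeMax τ) ≡⟨ cycleInsert-removeMax τ-perm ⟩
    τ                                         ∎
  where
  open ≡-Reasoning
  σ₀-perm = removeMax-isPerm σ-perm
  τ₀-perm = removeMax-isPerm τ-perm
  onto : {ρ : Word n} → IsPerm ρ → IsOnto (excToDes ρ)
  onto ρ-perm = Corresponds.onto (corresponds _ ρ-perm)

exc≡des∘excToDes : (σ : Word n) → IsPerm σ → exc σ ≡ des (excToDes σ)
exc≡des∘excToDes σ σ-perm = begin
  exc σ                     ≡⟨ excAux≡excSumFrom 0 (vals σ) ⟩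
  excSum above σ            ≡⟨ Corresponds.sums (corresponds σ σ-perm) (ifAbove-vanishing (λ _ _ → 1)) ⟩
  desSum above (excToDes σ) ≡⟨ sym (des≡desSum (excToDes σ)) ⟩
  des (excToDes σ)          ∎
  where open ≡-Reasoning

dexc≡ddes∘excToDes : (σ : Word n) → IsPerm σ → dexc σ ≡ ddes (excToDes σ)
dexc≡ddes∘excToDes σ σ-perm = begin
  dexc σ                      ≡⟨ dexcAux≡excSumFrom 0 (vals σ) ⟩
  excSum surplus σ            ≡⟨ Corresponds.sums (corresponds σ σ-perm) (ifAbove-vanishing (λ i p → p ∸ i)) ⟩
  desSum surplus (excToDes σ) ≡⟨ sym (ddes≡desSum (excToDes σ)) ⟩
  ddes (excToDes σ)           ∎
  where open ≡-Reasoning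

proposition1p1 : (n : ℕ) → n ≥ 1 → (e k : ℕ) →
    countPerms n (λ π → exc π ≡ e × dexc π ≡ k) (λ π → (exc π ≟ e) ×-dec (dexc π ≟ k))
    ≡ countPerms n (λ π → des π ≡ e × ddes π ≡ k) (λ π → (des π ≟ e) ×-dec (ddes π ≟ k))
proposition1p1 n _ e k = begin
  length (filter (λ w → isPerm? w ×-dec excStats? w) (allWords n n))
    ≡⟨ cong length (filter-×-dec isPerm? excStats? (allWords n n)) ⟩
  length (filter excStats? perms)
    ≡⟨ length-filter-reindex excStats? desStats? excToDes perms perms-unique
         (λ σ∈ → ∈-perms (excToDes-isPerm _ (isPerm-∈ σ∈)))
         (λ σ∈ τ∈ → excToDes-injective _ _ (isPerm-∈ σ∈) (isPerm-∈ τ∈))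
         (λ σ∈ → cong₂ (λ a b → does ((a ≟ e) ×-dec (b ≟ k)))
                   (exc≡des∘excToDes _ (isPerm-∈ σ∈)) (dexc≡ddes∘excToDes _ (isPerm-∈ σ∈))) ⟩
  length (filter desStats? perms)
    ≡⟨ cong length (sym (filter-×-dec isPerm? desStats? (allWords n n))) ⟩
  length (filter (λ w → isPerm? w ×-dec desStats? w) (allWords n n))
    ∎
  where
  open ≡-Reasoning
  excStats? desStats? : (π : Word n) → Dec _
  excStats? π = (exc π ≟ e) ×-dec (dexc π ≟ k)
  desStats? π = (des π ≟ e) ×-dec (ddes π ≟ k)
  perms : List (Word n)
  perms = filter isPerm? (allWords n n)
  perms-unique : Unique perms
  perms-unique = Unique.filter⁺ isPerm? (allWords-unique n n)
  ∈-perms : {σ : Word n} → IsPerm σ → σ ∈ₗ perms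
  ∈-perms σ-perm = ∈-filter⁺ isPerm? (∈-allWords _) σ-perm
  isPerm-∈ : {σ : Word n} → σ ∈ₗ perms → IsPerm σ
  isPerm-∈ σ∈ = proj₂ (∈-filter⁻ isPerm? {xs = allWords n n} σ∈)
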